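{- Let $N\geq 8$ be an integer, let $a,b$ be integers with $0\leq a\leq b\leq N$, and let $j\geq 0$ be an integer with $\lfloor j^2/4\rfloor<N$. Put $b_j=N(N-j)$ and $a_j=N^2-jN+\lfloor j^2/4\rfloor$. (1) If $a+b=j$, then $b_j\leq (N-a)(N-b)\leq a_j$. (2) If $b_j\leq (N-a)(N-b)\leq a_j$ and $a+b\neq j$, then $a+b=j+1$ and \[ N\leq ab\leq N+\tfrac{3}{2}\sqrt{N},\qquad N(N-j)\leq (N-a)(N-b)\leq N(N-j)+\tfrac{3}{2}\sqrt{N}. \] -}

module Defs where

open import Data.Nat using (ℕ; _/_)
import Data.Nat as ℕ
open import Data.Integer using (ℤ; +_; _+_; _-_; _*_)

bⱼ : ℕ → ℕ → ℤ
bⱼ N j = + N * (+ N - + j)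

⌊j²/4⌋ : ℕ → ℕ
⌊j²/4⌋ j = (j ℕ.* j) / 4

aⱼ : ℕ → ℕ → ℤ
aⱼ N j = + N * + N - + j * + N + + (⌊j²/4⌋ j)

prodDefect : ℕ → ℕ → ℕ → ℤ
prodDefect N a b = (+ N - + a) * (+ N - + b)

module Submission where

-- With s = a + b and p = a b one has (N - a)(N - b) = N² - sN + p, so the two bounds
-- b_j ≤ (N - a)(N - b) ≤ a_j say exactly (s - j) N ≤ p ≤ (s - j) N + ⌊j²/4⌋.
-- For s = j this is 0 ≤ ab ≤ ⌊s²/4⌋, i.e. AM-GM. The upper bound rules out s < j because
-- ⌊j²/4⌋ < N. For s ≥ j + 2, AM-GM for N - a and N - b gives
--   4N(N - j) ≤ 4(N - a)(N - b) ≤ (2N - s)² ≤ (2N - j - 2)² = 4N(N - j) + (j + 2)² - 8N,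
-- contradicting (j + 2)² < 8N, which follows from j² < 4N and j < N. Hence s = j + 1, the
-- excess ab - N = (N - a)(N - b) - N(N - j) is nonnegative, and 4ab ≤ (j + 1)² with j² < 4N
-- gives 2(ab - N) ≤ j, so 4(ab - N)² ≤ j² < 4N ≤ 9N.

open import Defs

module _ where
  open import Data.Integer.Base
  open import Data.Integer.Properties
  open import Data.Integer.Tactic.RingSolver using (solve-∀)
  import Data.Nat.Base as ℕ
  open import Data.Product.Base using (_×_; _,_)
  open import Function.Bundles using (_⇔_; mk⇔; Equivalence)
  open import Relation.Binary.PropositionalEquality
  open import Relation.Nullary.Negation using (¬_)
  open ≤-Reasoning

  gap-≡⇒≤ : ∀ {i j k l} → j - i ≡ l - k → k ≤ l → i ≤ j
  gap-≡⇒≤ eq k≤l = 0≤i-j⇒j≤i (subst (0ℤ ≤_) (sym eq) (i≤j⇒0≤j-i k≤l))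

  +*+-nonNeg : ∀ m n → 0ℤ ≤ + m * + n
  +*+-nonNeg m n = subst (0ℤ ≤_) (pos-* m n) (+≤+ ℕ.z≤n)

  +*+<+*+ : ∀ m n k l → m ℕ.* n ℕ.< k ℕ.* l → + m * + n < + k * + l
  +*+<+*+ m n k l mn<kl = subst₂ _<_ (pos-* m n) (pos-* k l) (+<+ mn<kl)

  square-nonNeg : ∀ i → 0ℤ ≤ i * i
  square-nonNeg (+ m)    = +*+-nonNeg m m
  square-nonNeg -[1+ m ] = +≤+ ℕ.z≤n

  square-mono-≤ : ∀ {i j} → 0ℤ ≤ i → i ≤ j → i * i ≤ j * j
  square-mono-≤ {i} {j} 0≤i i≤j = begin
    i * i ≤⟨ *-monoˡ-≤-nonNeg i {{nonNegative 0≤i}} i≤j ⟩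
    i * j ≤⟨ *-monoʳ-≤-nonNeg j {{nonNegative (≤-trans 0≤i i≤j)}} i≤j ⟩
    j * j ∎

  4xy≤[x+y]² : ∀ x y → + 4 * (x * y) ≤ (x + y) * (x + y)
  4xy≤[x+y]² x y = gap-≡⇒≤ (difference x y) (square-nonNeg (x - y))
    where
    difference : ∀ x y → (x + y) * (x + y) - + 4 * (x * y) ≡ (x - y) * (x - y) - 0ℤ
    difference = solve-∀

  lower-margin : ∀ n x y j → (n - x) * (n - y) - n * (n - j) ≡ x * y - (x + y - j) * n
  lower-margin = solve-∀

  upper-margin : ∀ n x y j q → (n * n - j * n + q) - (n - x) * (n - y) ≡ q - (x * y + (j - (x + y)) * n)
  upper-margin = solve-∀

  lower-bound⇔ : ∀ n x y j → n * (n - j) ≤ (n - x) * (n - y) ⇔ (x + y - j) * n ≤ x * y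
  lower-bound⇔ n x y j = mk⇔ (gap-≡⇒≤ (sym (lower-margin n x y j))) (gap-≡⇒≤ (lower-margin n x y j))

  upper-bound⇔ : ∀ n x y j q → (n - x) * (n - y) ≤ n * n - j * n + q ⇔ x * y + (j - (x + y)) * n ≤ q
  upper-bound⇔ n x y j q = mk⇔ (gap-≡⇒≤ (sym (upper-margin n x y j q))) (gap-≡⇒≤ (upper-margin n x y j q))

  x+y≡j⇒bounds : ∀ n x y j q → x + y ≡ j → 0ℤ ≤ x * y → x * y ≤ q →
                 n * (n - j) ≤ (n - x) * (n - y) × (n - x) * (n - y) ≤ n * n - j * n + q
  x+y≡j⇒bounds n x y .(x + y) q refl 0≤xy xy≤q =
      Equivalence.from (lower-bound⇔ n x y (x + y)) (subst (_≤ x * y) (sym no-shift) 0≤xy)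
    , Equivalence.from (upper-bound⇔ n x y (x + y) q)
        (subst (_≤ q) (sym (trans (cong (λ t → x * y + t) no-shift) (+-identityʳ (x * y)))) xy≤q)
    where
    no-shift : (x + y - (x + y)) * n ≡ 0ℤ
    no-shift = cong (_* n) (+-inverseʳ (x + y))

  x+y<j⇒¬upper-bound : ∀ n x y j q → 0ℤ ≤ n → 0ℤ ≤ x * y → q < n → x + y < j →
                       ¬ (n - x) * (n - y) ≤ n * n - j * n + q
  x+y<j⇒¬upper-bound n x y j q 0≤n 0≤xy q<n x+y<j upper = <-irrefl refl (begin-strict
    n                           ≡⟨ *-identityˡ n ⟨
    1ℤ * n                      ≤⟨ *-monoʳ-≤-nonNeg n {{nonNegative 0≤n}} 1≤j-[x+y] ⟩
    (j - (x + y)) * n           ≤⟨ i≤j+i _ (x * y) {{nonNegative 0≤xy}} ⟩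
    x * y + (j - (x + y)) * n   ≤⟨ Equivalence.to (upper-bound⇔ n x y j q) upper ⟩
    q                           <⟨ q<n ⟩
    n                           ∎)
    where
    shift : ∀ s j → j - s - 1ℤ ≡ j - (1ℤ + s) - 0ℤ
    shift = solve-∀
    1≤j-[x+y] : 1ℤ ≤ j - (x + y)
    1≤j-[x+y] = gap-≡⇒≤ (shift (x + y) j) (i≤j⇒0≤j-i (i<j⇒suc[i]≤j x+y<j))

  x+y≡1+j⇒excess-bounds : ∀ n x y j → 0ℤ ≤ n → x + y ≡ 1ℤ + j → j * j < + 4 * n →
                          n * (n - j) ≤ (n - x) * (n - y) →
                          n ≤ x * y × + 4 * ((x * y - n) * (x * y - n)) ≤ + 9 * n
                            × + 4 * (((n - x) * (n - y) - n * (n - j)) * ((n - x) * (n - y) - n * (n - j))) ≤ + 9 * n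
  x+y≡1+j⇒excess-bounds n x y j 0≤n x+y≡1+j j²<4n lower =
    n≤xy , excess-bound , subst (λ e → + 4 * (e * e) ≤ + 9 * n) (sym margin≡excess) excess-bound
    where
    unit-shift : (x + y - j) * n ≡ n
    unit-shift = trans (cong (λ s → (s - j) * n) x+y≡1+j) (cancel j n)
      where
      cancel : ∀ j n → (1ℤ + j - j) * n ≡ n
      cancel = solve-∀
    margin≡excess : (n - x) * (n - y) - n * (n - j) ≡ x * y - n
    margin≡excess = trans (lower-margin n x y j) (cong (λ t → x * y - t) unit-shift)
    n≤xy : n ≤ x * y
    n≤xy = subst (_≤ x * y) unit-shift (Equivalence.to (lower-bound⇔ n x y j) lower)
    -- AM-GM bounds x y by ((1 + j)/2)², and j² < 4n leaves room of only j/2 above n.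
    2e≤j : + 2 * (x * y - n) ≤ j
    2e≤j = *-cancelˡ-≤-pos _ _ (+ 2) (begin
      + 2 * (+ 2 * (x * y - n))       ≡⟨ expand-lhs (x * y) n ⟩
      + 4 * (x * y) - + 4 * n         ≤⟨ +-monoˡ-≤ (- (+ 4 * n)) (4xy≤[x+y]² x y) ⟩
      (x + y) * (x + y) - + 4 * n     ≡⟨ cong (λ s → s * s - + 4 * n) x+y≡1+j ⟩
      (1ℤ + j) * (1ℤ + j) - + 4 * n   ≡⟨ expand-rhs j n ⟩
      (1ℤ + j * j - + 4 * n) + + 2 * j ≤⟨ +-monoˡ-≤ (+ 2 * j) (i≤j⇒i-j≤0 (i<j⇒suc[i]≤j j²<4n)) ⟩
      0ℤ + + 2 * j                    ≡⟨ +-identityˡ (+ 2 * j) ⟩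
      + 2 * j                         ∎)
      where
      expand-lhs : ∀ p n → + 2 * (+ 2 * (p - n)) ≡ + 4 * p - + 4 * n
      expand-lhs = solve-∀
      expand-rhs : ∀ j n → (1ℤ + j) * (1ℤ + j) - + 4 * n ≡ (1ℤ + j * j - + 4 * n) + + 2 * j
      expand-rhs = solve-∀
    excess-bound : + 4 * ((x * y - n) * (x * y - n)) ≤ + 9 * n
    excess-bound = begin
      + 4 * ((x * y - n) * (x * y - n))             ≡⟨ double (x * y - n) ⟩
      (+ 2 * (x * y - n)) * (+ 2 * (x * y - n))     ≤⟨ square-mono-≤ (*-monoˡ-≤-nonNeg (+ 2) (i≤j⇒0≤j-i n≤xy)) 2e≤j ⟩
      j * j                                          ≤⟨ <⇒≤ j²<4n ⟩
      + 4 * n                                        ≤⟨ *-monoʳ-≤-nonNeg n {{nonNegative 0≤n}} {+ 4} {+ 9} (i≤i+j (+ 4) (+ 5)) ⟩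
      + 9 * n                                        ∎
      where
      double : ∀ e → + 4 * (e * e) ≡ (+ 2 * e) * (+ 2 * e)
      double = solve-∀

  2+j≤x+y⇒¬lower-bound : ∀ n x y j → x ≤ n → y ≤ n → (+ 2 + j) * (+ 2 + j) < + 8 * n → + 2 + j ≤ x + y →
                         ¬ n * (n - j) ≤ (n - x) * (n - y)
  2+j≤x+y⇒¬lower-bound n x y j x≤n y≤n [2+j]²<8n 2+j≤x+y lower = <-irrefl refl (begin-strict
    + 4 * (n * (n - j))                                          ≤⟨ *-monoˡ-≤-nonNeg (+ 4) lower ⟩
    + 4 * ((n - x) * (n - y))                                    ≤⟨ 4xy≤[x+y]² (n - x) (n - y) ⟩
    ((n - x) + (n - y)) * ((n - x) + (n - y))                    ≤⟨ square-mono-≤ 0≤u u≤2n-[2+j] ⟩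
    (+ 2 * n - (+ 2 + j)) * (+ 2 * n - (+ 2 + j))                ≡⟨ expand n j ⟩
    (+ 2 + j) * (+ 2 + j) + (+ 4 * (n * (n - j)) - + 8 * n)      <⟨ +-monoˡ-< _ [2+j]²<8n ⟩
    + 8 * n + (+ 4 * (n * (n - j)) - + 8 * n)                    ≡⟨ cancel n j ⟩
    + 4 * (n * (n - j))                                          ∎)
    where
    0≤u : 0ℤ ≤ (n - x) + (n - y)
    0≤u = +-mono-≤ (i≤j⇒0≤j-i x≤n) (i≤j⇒0≤j-i y≤n)
    u≤2n-[2+j] : (n - x) + (n - y) ≤ + 2 * n - (+ 2 + j)
    u≤2n-[2+j] = gap-≡⇒≤ (regroup n x y j) 2+j≤x+y
      where
      regroup : ∀ n x y j → (+ 2 * n - (+ 2 + j)) - ((n - x) + (n - y)) ≡ (x + y) - (+ 2 + j)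
      regroup = solve-∀
    expand : ∀ n j → (+ 2 * n - (+ 2 + j)) * (+ 2 * n - (+ 2 + j)) ≡ (+ 2 + j) * (+ 2 + j) + (+ 4 * (n * (n - j)) - + 8 * n)
    expand = solve-∀
    cancel : ∀ n j → + 8 * n + (+ 4 * (n * (n - j)) - + 8 * n) ≡ + 4 * (n * (n - j))
    cancel = solve-∀

module _ where
  open import Data.Nat.Base
  open import Data.Nat.Properties
  open import Data.Nat.DivMod using (m≡m%n+[m/n]*n; m%n<n; m*n/n≡m; /-monoˡ-≤)
  import Data.Integer.Base as ℤ
  open import Data.Integer.Properties using (pos-*; drop‿+≤+)
  open import Data.Nat.Tactic.RingSolver using (solve-∀)
  open import Relation.Binary.PropositionalEquality
  open ≤-Reasoning

  4mn≤[m+n]² : ∀ m n → 4 * (m * n) ≤ (m + n) * (m + n)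
  4mn≤[m+n]² m n = drop‿+≤+ (subst₂ ℤ._≤_ (sym cast-lhs) (sym (pos-* (m + n) (m + n))) (4xy≤[x+y]² (ℤ.+ m) (ℤ.+ n)))
    where
    cast-lhs : ℤ.+ (4 * (m * n)) ≡ ℤ.+ 4 ℤ.* (ℤ.+ m ℤ.* ℤ.+ n)
    cast-lhs = trans (pos-* 4 (m * n)) (cong (ℤ.+ 4 ℤ.*_) (pos-* m n))

  m*n≤⌊[m+n]²/4⌋ : ∀ m n → m * n ≤ ⌊j²/4⌋ (m + n)
  m*n≤⌊[m+n]²/4⌋ m n = begin
    m * n                      ≡⟨ m*n/n≡m (m * n) 4 ⟨
    m * n * 4 / 4              ≡⟨ cong (_/ 4) (*-comm (m * n) 4) ⟩
    4 * (m * n) / 4            ≤⟨ /-monoˡ-≤ 4 (4mn≤[m+n]² m n) ⟩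
    (m + n) * (m + n) / 4      ∎

  ⌊j²/4⌋<n⇒j²<4n : ∀ j {n} → ⌊j²/4⌋ j < n → j * j < 4 * n
  ⌊j²/4⌋<n⇒j²<4n j {n} q<n = begin-strict
    j * j                            ≡⟨ m≡m%n+[m/n]*n (j * j) 4 ⟩
    j * j % 4 + ⌊j²/4⌋ j * 4          <⟨ +-monoˡ-< (⌊j²/4⌋ j * 4) (m%n<n (j * j) 4) ⟩
    4 + ⌊j²/4⌋ j * 4                  ≡⟨ cong (4 +_) (*-comm (⌊j²/4⌋ j) 4) ⟩
    4 + 4 * ⌊j²/4⌋ j                  ≡⟨ *-suc 4 (⌊j²/4⌋ j) ⟨
    4 * suc (⌊j²/4⌋ j)                ≤⟨ *-monoʳ-≤ 4 q<n ⟩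
    4 * n                            ∎

  m²<kn⇒m<n : ∀ m {k n} → k ≤ n → m * m < k * n → m < n
  m²<kn⇒m<n m {k} {n} k≤n m²<kn = ≰⇒> λ n≤m → n≮n (m * m) (begin-strict
    m * m   <⟨ m²<kn ⟩
    k * n   ≤⟨ *-monoˡ-≤ n k≤n ⟩
    n * n   ≤⟨ *-mono-≤ n≤m n≤m ⟩
    m * m   ∎)

  [2+m]²<8n : ∀ m {n} → m * m < 4 * n → m < n → (2 + m) * (2 + m) < 8 * n
  [2+m]²<8n m {n} m²<4n m<n = begin-strict
    (2 + m) * (2 + m)    ≡⟨ expand m ⟩
    m * m + 4 * suc m    <⟨ +-mono-<-≤ m²<4n (*-monoʳ-≤ 4 m<n) ⟩
    4 * n + 4 * n        ≡⟨ double n ⟩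
    8 * n                ∎
    where
    expand : ∀ m → (2 + m) * (2 + m) ≡ m * m + 4 * (1 + m)
    expand = solve-∀
    double : ∀ n → 4 * n + 4 * n ≡ 8 * n
    double = solve-∀

open import Data.Nat using (ℕ; _≤_; _<_)
import Data.Nat as ℕ
open import Data.Integer using (ℤ; +_; _-_; _*_)
import Data.Integer as ℤ
open import Relation.Binary.PropositionalEquality using (_≡_; _≢_)
open import Data.Product using (_×_)

open import Data.Nat.Properties using (≤-antisym; ≤-pred; ≤-trans; ≰⇒>; ≮⇒≥; ≤∧≢⇒<; m≤m+n)
open import Data.Integer.Properties using (pos-*; drop‿+≤+)
open import Data.Product using (_,_)
open import Relation.Binary.PropositionalEquality using (cong; subst; sym; ≢-sym)
open import Relation.Nullary.Negation using (¬_)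

sum≡j⇒bounds : ∀ N a b j → a ℕ.+ b ≡ j → (bⱼ N j ℤ.≤ prodDefect N a b) × (prodDefect N a b ℤ.≤ aⱼ N j)
sum≡j⇒bounds N a b j s≡j =
  x+y≡j⇒bounds (+ N) (+ a) (+ b) (+ j) (+ ⌊j²/4⌋ j) (cong +_ s≡j) (+*+-nonNeg a b)
    (subst (ℤ._≤ + ⌊j²/4⌋ j) (pos-* a b) (ℤ.+≤+ (subst (λ s → a ℕ.* b ≤ ⌊j²/4⌋ s) s≡j (m*n≤⌊[m+n]²/4⌋ a b))))

bounds⇒sum≡1+j : ∀ N a b j → 4 ≤ N → a ≤ N → b ≤ N → ⌊j²/4⌋ j < N →
                 bⱼ N j ℤ.≤ prodDefect N a b → prodDefect N a b ℤ.≤ aⱼ N j → a ℕ.+ b ≢ j → a ℕ.+ b ≡ ℕ.suc j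
bounds⇒sum≡1+j N a b j 4≤N a≤N b≤N q<N lower upper s≢j =
  ≤-antisym (≤-pred (≰⇒> 2+j≰s)) (≤∧≢⇒< j≤s (≢-sym s≢j))
  where
  j≤s : j ≤ a ℕ.+ b
  j≤s = ≮⇒≥ λ s<j → x+y<j⇒¬upper-bound (+ N) (+ a) (+ b) (+ j) (+ ⌊j²/4⌋ j)
                      (ℤ.+≤+ ℕ.z≤n) (+*+-nonNeg a b) (ℤ.+<+ q<N) (ℤ.+<+ s<j) upper
  2+j≰s : ¬ (2 ℕ.+ j ≤ a ℕ.+ b)
  2+j≰s 2+j≤s = 2+j≤x+y⇒¬lower-bound (+ N) (+ a) (+ b) (+ j) (ℤ.+≤+ a≤N) (ℤ.+≤+ b≤N)
                  (+*+<+*+ (2 ℕ.+ j) (2 ℕ.+ j) 8 N ([2+m]²<8n j j²<4N (m²<kn⇒m<n j 4≤N j²<4N))) (ℤ.+≤+ 2+j≤s) lower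
    where
    j²<4N : j ℕ.* j < 4 ℕ.* N
    j²<4N = ⌊j²/4⌋<n⇒j²<4n j q<N

sum≡1+j⇒excess-bounds : ∀ N a b j → ⌊j²/4⌋ j < N → a ℕ.+ b ≡ ℕ.suc j → bⱼ N j ℤ.≤ prodDefect N a b →
    (N ≤ a ℕ.* b)
    × (+ 4 * ((+ (a ℕ.* b) - + N) * (+ (a ℕ.* b) - + N)) ℤ.≤ + 9 * + N)
    × (+ 4 * ((prodDefect N a b - + N * (+ N - + j)) * (prodDefect N a b - + N * (+ N - + j))) ℤ.≤ + 9 * + N)
sum≡1+j⇒excess-bounds N a b j q<N s≡1+j lower
  with x+y≡1+j⇒excess-bounds (+ N) (+ a) (+ b) (+ j) (ℤ.+≤+ ℕ.z≤n) (cong +_ s≡1+j)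
         (+*+<+*+ j j 4 N (⌊j²/4⌋<n⇒j²<4n j q<N)) lower
... | N≤ab , excess , margin rewrite pos-* a b = drop‿+≤+ (subst (+ N ℤ.≤_) (sym (pos-* a b)) N≤ab) , excess , margin

lemma4p2 : (N a b j : ℕ) → 8 ≤ N → a ≤ b → b ≤ N → ⌊j²/4⌋ j < N →
    ((a ℕ.+ b ≡ j → (bⱼ N j ℤ.≤ prodDefect N a b) × (prodDefect N a b ℤ.≤ aⱼ N j))
    × ((bⱼ N j ℤ.≤ prodDefect N a b) → (prodDefect N a b ℤ.≤ aⱼ N j) → a ℕ.+ b ≢ j →
        (a ℕ.+ b ≡ ℕ.suc j)
        × (N ≤ a ℕ.* b)
        × (+ 4 * ((+ (a ℕ.* b) - + N) * (+ (a ℕ.* b) - + N)) ℤ.≤ + 9 * + N)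
        × (+ N * (+ N - + j) ℤ.≤ prodDefect N a b)
        × (+ 4 * ((prodDefect N a b - + N * (+ N - + j)) * (prodDefect N a b - + N * (+ N - + j))) ℤ.≤ + 9 * + N)))
lemma4p2 N a b j 8≤N a≤b b≤N q<N = sum≡j⇒bounds N a b j , λ lower upper s≢j →
  let s≡1+j = bounds⇒sum≡1+j N a b j (≤-trans (m≤m+n 4 4) 8≤N) (≤-trans a≤b b≤N) b≤N q<N lower upper s≢j
      (N≤ab , excess , margin) = sum≡1+j⇒excess-bounds N a b j q<N s≡1+j lower
  in s≡1+j , N≤ab , excess , lower , margin
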